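{- Let $\mathcal C$ and $\mathcal D$ be neural codes and suppose that $\mathcal C$ covers $\mathcal D$ in $\mathbf{P}_{\mathbf{Code}}$. Then $\widehat{\mathcal C}$ is isomorphic to $\widehat{\mathcal D}_{[\mathcal I]}$ for some isolated subset $\mathcal I\subseteq\widehat{\mathcal D}$.
   Context: A neural code is a set $\mathcal C\subseteq 2^{[n]}$ containing $\varnothing$. For $\sigma\subseteq[n]$, the trunk $\mathrm{Tk}_{\mathcal C}(\sigma)=\{\tau\in\mathcal C:\sigma\subseteq\tau\}$; a trunk is proper if nonempty and not equal to $\mathcal C$. A morphism $f:\mathcal C\to\mathcal D$ is a function such that the preimage of every proper trunk in $\mathcal D$ is a proper trunk in $\mathcal C$; an isomorphism is a bijective morphism whose inverse is a morphism. Write $\mathcal D\le\mathcal C$ if there is a surjective morphism $\mathcal C\to\mathcal D$; this partial order on isomorphism classes is $\mathbf{P}_{\mathbf{Code}}$, and $\mathcal C$ covers $\mathcal D$ if $\mathcal D<\mathcal C$ with no $\mathcal E$ satisfying $\mathcal D<\mathcal E<\mathcal C$. A code is intersection-complete if closed under pairwise intersection; the intersection-completion $\widehat{\mathcal C}$ is the set of all intersections of nonempty subfamilies of $\mathcal C$. If $\mathcal E$ is intersection-complete, a subset $\mathcal I\subseteq\mathcal E$ is isolated if it is nonempty and closed under pairwise intersection (so it has a least element $\mu$), and there are no $\sigma\in\mathcal E\setminus\mathcal I$ and $\tau\in\mathcal I\setminus\{\mu\}$ with $\tau\subseteq\sigma$. For such $\mathcal I$, with $\alpha$ a new neuron not in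 the ground set and $(S)_\alpha=\{c\cup\{\alpha\}:c\in S\}$, define $\mathcal E_{[\mathcal I]}=\{\mu\}\cup(\mathcal E\setminus\mathcal I)\cup(\mathcal I)_\alpha$. -}

module Defs where

open import Data.Nat using (ℕ; suc)
open import Data.Bool using (true; false)
open import Data.Fin.Subset using (Subset; _⊆_; _∩_; ⊥)
open import Data.Vec using (_∷_)
open import Data.List.NonEmpty using (List⁺; foldr₁)
open import Data.List.NonEmpty.Relation.Unary.All using (All)
open import Data.Product using (Σ; ∃; ∃₂; _×_; _,_)
open import Data.Sum using (_⊎_)
open import Relation.Nullary using (¬_)
open import Relation.Binary.PropositionalEquality using (_≡_; _≢_)
open import Function.Bundles using (_⇔_)

record Code (n : ℕ) : Set₁ where
  field
    mem : Subset n → Set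
open Code public

IsNeural : ∀ {n} → Code n → Set
IsNeural C = mem C ⊥

ProperTk : ∀ {n} → Code n → Subset n → Set
ProperTk C σ = (∃ λ c → mem C c × σ ⊆ c) × ¬ (∀ c → mem C c → σ ⊆ c)

IsMorphism : ∀ {n m} → Code n → Code m → (Subset n → Subset m) → Set
IsMorphism C D f =
  (∀ c → mem C c → mem D (f c)) ×
  (∀ σ → ProperTk D σ →
     ∃ λ τ → ProperTk C τ × (∀ c → mem C c → (σ ⊆ f c ⇔ τ ⊆ c)))

SurjectiveOn : ∀ {n m} → Code n → Code m → (Subset n → Subset m) → Set
SurjectiveOn C D f = ∀ d → mem D d → ∃ λ c → mem C c × f c ≡ d

_≅_ : ∀ {n m} → Code n → Code m → Set
_≅_ {n} {m} C D =
  Σ (Subset n → Subset m) λ f → Σ (Subset m → Subset n) λ g →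
    IsMorphism C D f × IsMorphism D C g ×
    (∀ c → mem C c → g (f c) ≡ c) × (∀ d → mem D d → f (g d) ≡ d)

_≤C_ : ∀ {m n} → Code m → Code n → Set
_≤C_ {m} {n} D C = Σ (Subset n → Subset m) λ f → IsMorphism C D f × SurjectiveOn C D f

_<C_ : ∀ {m n} → Code m → Code n → Set
D <C C = D ≤C C × ¬ (C ≅ D)

Covers : ∀ {n m} → Code n → Code m → Set₁
Covers C D = D <C C × ¬ (Σ ℕ λ k → Σ (Code k) λ E → IsNeural E × D <C E × E <C C)

⋂⁺ : ∀ {n} → List⁺ (Subset n) → Subset n
⋂⁺ = foldr₁ _∩_

completion : ∀ {n} → Code n → Code n
completion C = record
  { mem = λ c → Σ (List⁺ _) λ F → All (mem C) F × ⋂⁺ F ≡ c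
  }

IsLeast : ∀ {n} → (Subset n → Set) → Subset n → Set
IsLeast I μ = I μ × (∀ τ → I τ → μ ⊆ τ)

Isolated : ∀ {n} → Code n → (Subset n → Set) → Set
Isolated E I =
  (∀ c → I c → mem E c) ×
  (∃ I) ×
  (∀ a b → I a → I b → I (a ∩ b)) ×
  (∀ μ → IsLeast I μ →
     ¬ (∃₂ λ σ τ → mem E σ × ¬ I σ × I τ × τ ≢ μ × τ ⊆ σ))

-- E_[I] on ground set [n] ⊔ {α}, the new neuron α being index 0:
-- (true ∷ c) represents c ∪ {α}, (false ∷ c) represents c.
split : ∀ {n} → (E : Code n) → (Subset n → Set) → Subset n → Code (suc n)
split {n} E I μ = record
  { mem = m' }
  where
  m' : Subset (suc n) → Set
  m' (false ∷ c) = c ≡ μ ⊎ (mem E c × ¬ I c)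
  m' (true ∷ c) = I c

-- A surjective morphism f : C → D induces maps ĥ e = ⋂ {f c ∣ e ⊆ c ∈ C} and
-- ǧ y = ⋂ {c ∈ C ∣ y ⊆ f c} forming a Galois connection ǧ y ⊆ e ⇔ y ⊆ ĥ e between Ĉ and D̂,
-- with ĥ ∘ ǧ = id. Hence |D̂| ≤ |Ĉ|, strictly once ĥ identifies two elements of Ĉ, and if
-- ǧ ∘ ĥ fixes every element of Ĉ then f is an isomorphism. As C ≇ D, some x ∈ Ĉ is moved
-- by ǧ ∘ ĥ. For moved x, y with x ⊈ y, the code E = {(x ⊆ c) ∷ f c ∣ c ∈ C}, whose new
-- neuron records x ⊆ c, lies strictly between D and C: C → E identifies y with ǧ (ĥ y), and
-- E → D identifies the images of x and ǧ (ĥ x). So when C covers D, x is the only moved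
-- element, and e ↦ (x ⊆ e) ∷ ĥ e is an isomorphism from Ĉ onto D̂_[I], where
-- I = ĥ (Tk_Ĉ(x)) has least element ĥ x.
module Submission where

open import Defs
open import Data.Fin.Subset using (Subset)
open import Data.Product using (Σ; _×_)
open import Relation.Nullary using (Dec)

open import Data.Bool.Properties using () renaming (_≟_ to _≟ᵇ_)
open import Data.Empty using (⊥-elim)
open import Data.Fin.Subset using (_⊆_; _∩_; _∪_; ⊥; ⊤; inside; outside)
open import Data.Fin.Subset.Properties
  using ( _⊆?_; anySubset?; ⊆-refl; ⊆-trans; ⊆-antisym; ⊥⊆; ⊆⊤; drop-∷-⊆; out⊆; out⊆-⇔; in⊆in
        ; p∩q⊆p; p∩q⊆q; x∈p∩q⁺; p⊆p∪q; q⊆p∪q; x∈p∪q⁻; ∩-identityʳ )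
open import Data.List using (List; []; _∷_; foldr; map; filter; length; cartesianProductWith)
open import Data.List.Properties using (filter-notAll; length-map; map-∘; map-id-local)
open import Data.List.Membership.Propositional using () renaming (_∈_ to _∈ₗ_; _∉_ to _∉ₗ_)
open import Data.List.Membership.Propositional.Properties
  using (∈-filter⁺; ∈-filter⁻; ∈-map⁺; ∈-map⁻; ∈-cartesianProductWith⁺)
open import Data.List.NonEmpty using (_∷_)
open import Data.List.NonEmpty.Relation.Unary.All using (_∷_)
open import Data.List.Relation.Binary.Subset.Propositional using () renaming (_⊆_ to _⊆ₗ_)
open import Data.List.Relation.Unary.All as All using ([]; _∷_)
open import Data.List.Relation.Unary.All.Properties as All using (all-filter)
open import Data.List.Relation.Unary.AllPairs using ([]; _∷_)
open import Data.List.Relation.Unary.Any as Any using (here; there)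
open import Data.List.Relation.Unary.Unique.Propositional using (Unique)
import Data.List.Relation.Unary.Unique.Propositional.Properties as Unique
open import Data.Nat using (ℕ; zero; suc; _≤_; _<_; z≤n; s≤s)
open import Data.Nat.Properties using (≤-trans; ≤-<-trans; <⇒≱)
open import Data.Product using (∃; ∃₂; _,_; proj₁; proj₂)
open import Data.Product.Function.NonDependent.Propositional using (_×-⇔_)
open import Data.Sum using (inj₁; inj₂)
open import Data.Vec using ([]; _∷_; here; tail)
open import Data.Vec.Properties using (∷-injective; ≡-dec)
open import Function using (_∘_; id)
open import Function.Bundles using (_⇔_; mk⇔; Equivalence)
import Function.Properties.Equivalence as ⇔
import Function.Related.Propositional as Related
open import Level using (0ℓ)
open import Relation.Binary.Definitions using (DecidableEquality)
open import Relation.Binary.PropositionalEquality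
  using (_≡_; _≢_; refl; sym; trans; cong; cong₂; subst; ≢-sym; module ≡-Reasoning)
open import Relation.Nullary using (¬_; yes; no; ¬?; does; contradiction)
open import Relation.Nullary.Decidable using (_×-dec_; dec-true; dec-false; decidable-stable)
open import Relation.Unary using (Pred; Decidable)

private
  variable
    n m : ℕ

-- Finite enumeration and counting

module _ {X : Set} (_≟_ : DecidableEquality X) where

  private
    without : X → List X → List X
    without x = filter (λ y → ¬? (y ≟ x))

    ∈-without : ∀ {x y ys} → y ∈ₗ ys → y ≢ x → y ∈ₗ without x ys
    ∈-without = ∈-filter⁺ (λ y → ¬? (y ≟ _))

    length-without : ∀ {x ys} → x ∈ₗ ys → length (without x ys) < length ys
    length-without x∈ys = filter-notAll _ _ (Any.map (λ x≡y y≢x → y≢x (sym x≡y)) x∈ys)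

  Unique-⊆⇒length≤ : ∀ {xs ys} → Unique xs → xs ⊆ₗ ys → length xs ≤ length ys
  Unique-⊆⇒length≤ []              _     = z≤n
  Unique-⊆⇒length≤ (x≢xs ∷ xs-uniq) xs⊆ys = ≤-trans
    (s≤s (Unique-⊆⇒length≤ xs-uniq λ y∈xs →
      ∈-without (xs⊆ys (there y∈xs)) (≢-sym (All.lookup x≢xs y∈xs))))
    (length-without (xs⊆ys (here refl)))

  Unique-⊂⇒length< : ∀ {xs ys y} → Unique xs → xs ⊆ₗ ys → y ∈ₗ ys → y ∉ₗ xs →
                     length xs < length ys
  Unique-⊂⇒length< xs-uniq xs⊆ys y∈ys y∉xs = ≤-<-trans
    (Unique-⊆⇒length≤ xs-uniq λ z∈xs →
      ∈-without (xs⊆ys z∈xs) λ { refl → y∉xs z∈xs })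
    (length-without y∈ys)

_≟_ : DecidableEquality (Subset n)
_≟_ = ≡-dec _≟ᵇ_

subsets : ∀ n → List (Subset n)
subsets zero    = [] ∷ []
subsets (suc n) = cartesianProductWith _∷_ (inside ∷ outside ∷ []) (subsets n)

∈-subsets : (p : Subset n) → p ∈ₗ subsets n
∈-subsets []      = here refl
∈-subsets (b ∷ p) = ∈-cartesianProductWith⁺ _∷_ (∈-bits b) (∈-subsets p)
  where
  ∈-bits : ∀ b → b ∈ₗ inside ∷ outside ∷ []
  ∈-bits inside  = here refl
  ∈-bits outside = there (here refl)

subsets-unique : ∀ n → Unique (subsets n)
subsets-unique zero    = [] ∷ []
subsets-unique (suc n) =
  Unique.cartesianProductWith⁺ _∷_ ∷-injective (((λ ()) ∷ []) ∷ [] ∷ []) (subsets-unique n)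

∩-greatest : ∀ {p q r : Subset n} → p ⊆ q → p ⊆ r → p ⊆ q ∩ r
∩-greatest p⊆q p⊆r x∈p = x∈p∩q⁺ (p⊆q x∈p , p⊆r x∈p)

∪-least : ∀ {p q r : Subset n} → p ⊆ r → q ⊆ r → p ∪ q ⊆ r
∪-least {p = p} {q} p⊆r q⊆r x∈p∪q with x∈p∪q⁻ p q x∈p∪q
... | inj₁ x∈p = p⊆r x∈p
... | inj₂ x∈q = q⊆r x∈q

p⊆q⇒p∪q≡q : ∀ {p q : Subset n} → p ⊆ q → p ∪ q ≡ q
p⊆q⇒p∪q≡q {p = p} {q} p⊆q = ⊆-antisym (∪-least p⊆q ⊆-refl) (q⊆p∪q p q)

q⊆p⇒p∪q≡p : ∀ {p q : Subset n} → q ⊆ p → p ∪ q ≡ p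
q⊆p⇒p∪q≡p {q = q} q⊆p = ⊆-antisym (∪-least ⊆-refl q⊆p) (p⊆p∪q q)

⋂ : List (Subset n) → Subset n
⋂ = foldr _∩_ ⊤

⋂-lb : ∀ {s : Subset n} {ss} → s ∈ₗ ss → ⋂ ss ⊆ s
⋂-lb {ss = s ∷ ss} (here refl) = p∩q⊆p s (⋂ ss)
⋂-lb {ss = s ∷ ss} (there s∈ss) = ⊆-trans (p∩q⊆q s (⋂ ss)) (⋂-lb s∈ss)

⋂-glb : ∀ {w : Subset n} ss → (∀ {s} → s ∈ₗ ss → w ⊆ s) → w ⊆ ⋂ ss
⋂-glb []       _    = ⊆⊤
⋂-glb (s ∷ ss) w⊆ss = ∩-greatest (w⊆ss (here refl)) (⋂-glb ss (w⊆ss ∘ there))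

⋂⁺-∷ : ∀ (s : Subset n) ss → ⋂⁺ (s ∷ ss) ≡ s ∩ ⋂ ss
⋂⁺-∷ s []       = sym (∩-identityʳ s)
⋂⁺-∷ s (t ∷ ss) = cong (s ∩_) (⋂⁺-∷ t ss)

∪-⊆-⇔ : ∀ {p q r : Subset n} → (p ∪ q ⊆ r) ⇔ (p ⊆ r × q ⊆ r)
∪-⊆-⇔ {p = p} {q} {r} = mk⇔ to λ (p⊆r , q⊆r) → ∪-least p⊆r q⊆r
  where
  to : p ∪ q ⊆ r → p ⊆ r × q ⊆ r
  to p∪q⊆r = ⊆-trans (p⊆p∪q q) p∪q⊆r , ⊆-trans (q⊆p∪q p q) p∪q⊆r

in⊆does-⇔ : ∀ {P : Set} (P? : Dec P) {p q : Subset n} → (inside ∷ p ⊆ does P? ∷ q) ⇔ (P × p ⊆ q)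
in⊆does-⇔ {P = P} P? {p} {q} = mk⇔ (to P?) (from P?)
  where
  to : (P? : Dec P) → inside ∷ p ⊆ does P? ∷ q → P × p ⊆ q
  to (yes holds) ip⊆iq = holds , drop-∷-⊆ ip⊆iq
  to (no _)      ip⊆oq = contradiction (ip⊆oq here) λ ()
  from : (P? : Dec P) → P × p ⊆ q → inside ∷ p ⊆ does P? ∷ q
  from (yes _)    (_ , p⊆q)  = in⊆in p⊆q
  from (no fails) (holds , _) = contradiction holds fails

⊆-tail-⇔ : ∀ {p : Subset n} z → (p ⊆ tail z) ⇔ (outside ∷ p ⊆ z)
⊆-tail-⇔ (_ ∷ _) = out⊆-⇔

tail-mono : ∀ {z w : Subset (suc n)} → z ⊆ w → tail z ⊆ tail w
tail-mono {z = _ ∷ _} {_ ∷ _} = drop-∷-⊆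

-- Morphisms from trunk adjunctions

NonemptyTk : Code n → Subset n → Set
NonemptyTk A σ = ∃ λ c → mem A c × σ ⊆ c

Adjoint : Code n → Code m → (Subset m → Subset n) → (Subset n → Subset m) → Set
Adjoint A B g h = ∀ σ c → NonemptyTk B σ → mem A c → (σ ⊆ h c ⇔ g σ ⊆ c)

adjoint⇒IsMorphism : ∀ {A : Code n} {B : Code m} {g h} →
                     (∀ c → mem A c → mem B (h c)) → SurjectiveOn A B h → Adjoint A B g h →
                     IsMorphism A B h
adjoint⇒IsMorphism {A = A} {B} {g} {h} h-into h-onto adj =
  h-into , λ σ σ-proper → g σ , proper σ-proper , λ c c∈A → adj σ c (proj₁ σ-proper) c∈A
  where
  proper : ∀ {σ} → ProperTk B σ → ProperTk A (g σ)
  proper {σ} (σ-nonempty@(d , d∈B , σ⊆d) , σ-not-all) with h-onto d d∈B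
  ... | c , c∈A , refl =
    (c , c∈A , Equivalence.to (adj σ c σ-nonempty c∈A) σ⊆d) ,
    λ gσ-all → σ-not-all λ d′ d′∈B → below-all gσ-all (h-onto d′ d′∈B)
    where
    below-all : (∀ c → mem A c → g σ ⊆ c) → ∀ {d′} → (∃ λ c → mem A c × h c ≡ d′) → σ ⊆ d′
    below-all gσ-all (c′ , c′∈A , refl) =
      Equivalence.from (adj σ c′ σ-nonempty c′∈A) (gσ-all c′ c′∈A)

inverse-adjoints⇒≅ : ∀ {A : Code n} {B : Code m} {F G F̂} →
                     (∀ c → mem A c → mem B (F c)) → (∀ z → mem B z → mem A (G z)) →
                     (∀ c → mem A c → G (F c) ≡ c) → (∀ z → mem B z → F (G z) ≡ z) →
                     Adjoint A B G F → Adjoint B A F̂ G → A ≅ B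
inverse-adjoints⇒≅ {F = F} {G} F-into G-into GF FG F-adj G-adj =
  F , G ,
  adjoint⇒IsMorphism F-into (λ z z∈B → G z , G-into z z∈B , FG z z∈B) F-adj ,
  adjoint⇒IsMorphism G-into (λ c c∈A → F c , F-into c c∈A , GF c c∈A) G-adj ,
  GF , FG

≅⇒≤C : {A : Code n} {B : Code m} → A ≅ B → A ≤C B
≅⇒≤C (F , G , F-mor , G-mor , GF , FG) =
  G , G-mor , λ c c∈A → F c , proj₁ F-mor c c∈A , GF c c∈A

-- Closure and completion

module Closure {a} {A : Code a} (A? : Decidable (mem A)) where

  codewords : List (Subset a)
  codewords = filter A? (subsets a)

  ⋀ : ∀ {b} {P : Pred (Subset a) 0ℓ} → Decidable P → (Subset a → Subset b) → Subset b
  ⋀ P? φ = ⋂ (map φ (filter P? codewords))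

  module _ {b} {P : Pred (Subset a) 0ℓ} (P? : Decidable P) (φ : Subset a → Subset b) where

    ⋀-lb : ∀ {c} → mem A c → P c → ⋀ P? φ ⊆ φ c
    ⋀-lb c∈A Pc = ⋂-lb (∈-map⁺ φ (∈-filter⁺ P? (∈-filter⁺ A? (∈-subsets _) c∈A) Pc))

    ⋀-glb : ∀ {w} → (∀ c → mem A c → P c → w ⊆ φ c) → w ⊆ ⋀ P? φ
    ⋀-glb {w} w⊆φ = ⋂-glb _ below
      where
      below : ∀ {s} → s ∈ₗ map φ (filter P? codewords) → w ⊆ s
      below s∈ with c , c∈ , refl ← ∈-map⁻ φ s∈
                 with c∈codewords , Pc ← ∈-filter⁻ P? {xs = codewords} c∈
        = w⊆φ c (proj₂ (∈-filter⁻ A? {xs = subsets a} c∈codewords)) Pc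

  cl : Subset a → Subset a
  cl e = ⋀ (e ⊆?_) id

  cl-lb : ∀ {e c} → mem A c → e ⊆ c → cl e ⊆ c
  cl-lb {e} = ⋀-lb (e ⊆?_) id

  cl-glb : ∀ {e w} → (∀ c → mem A c → e ⊆ c → w ⊆ c) → w ⊆ cl e
  cl-glb {e} = ⋀-glb (e ⊆?_) id

  ⊆-cl : ∀ {e} → e ⊆ cl e
  ⊆-cl = cl-glb λ _ _ e⊆c → e⊆c

  cl-mono : ∀ {e e′} → e ⊆ e′ → cl e ⊆ cl e′
  cl-mono e⊆e′ = cl-glb λ c c∈A e′⊆c → cl-lb c∈A (⊆-trans e⊆e′ e′⊆c)

  -- cl e is the empty intersection ⊤ when no codeword contains e, hence the first conjunct.
  Closed : Subset a → Set
  Closed e = NonemptyTk A e × cl e ⊆ e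

  Closed? : Decidable Closed
  Closed? e = anySubset? (λ c → A? c ×-dec (e ⊆? c)) ×-dec (cl e ⊆? e)

  closed-lub : ∀ {e w} → Closed w → e ⊆ w → cl e ⊆ w
  closed-lub (_ , cl-w⊆w) e⊆w = ⊆-trans (cl-mono e⊆w) cl-w⊆w

  codeword-closed : ∀ {c} → mem A c → Closed c
  codeword-closed c∈A = (_ , c∈A , ⊆-refl) , cl-lb c∈A ⊆-refl

  cl-closed : ∀ {e} → NonemptyTk A e → Closed (cl e)
  cl-closed (c , c∈A , e⊆c) =
    (c , c∈A , cl-lb c∈A e⊆c) , cl-glb λ d d∈A e⊆d → cl-lb d∈A (cl-lb d∈A e⊆d)

  ∩-closed : ∀ {e e′} → Closed e → Closed e′ → Closed (e ∩ e′)
  ∩-closed {e} {e′} e-closed@((c , c∈A , e⊆c) , _) e′-closed =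
    (c , c∈A , ⊆-trans (p∩q⊆p e e′) e⊆c) ,
    ∩-greatest (closed-lub e-closed (p∩q⊆p e e′)) (closed-lub e′-closed (p∩q⊆q e e′))

  completion⇒closed : ∀ {e} → mem (completion A) e → Closed e
  completion⇒closed (c ∷ cs , c∈A ∷ cs⊆A , refl) = subst Closed (sym (⋂⁺-∷ c cs))
    ( (c , c∈A , p∩q⊆p c (⋂ cs))
    , ∩-greatest (cl-lb c∈A (p∩q⊆p c (⋂ cs)))
                 (⋂-glb cs λ d∈cs →
                   cl-lb (All.lookup cs⊆A d∈cs) (⊆-trans (p∩q⊆q c (⋂ cs)) (⋂-lb d∈cs))))

  closed⇒completion : ∀ {e} → Closed e → mem (completion A) e
  closed⇒completion {e} ((c , c∈A , e⊆c) , cl-e⊆e) =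
    c ∷ trunk , c∈A ∷ All.map⁺ (All.filter⁺ _ (all-filter A? (subsets a))) ,
    trans (⋂⁺-∷ c trunk) (⊆-antisym (⊆-trans (p∩q⊆q c (cl e)) cl-e⊆e) (∩-greatest e⊆c ⊆-cl))
    where
    trunk : List (Subset a)
    trunk = map id (filter (e ⊆?_) codewords)

  completion-nonempty : ∀ {e} → NonemptyTk (completion A) e → NonemptyTk A e
  completion-nonempty (w , w∈Â , e⊆w) with c , c∈A , w⊆c ← proj₁ (completion⇒closed w∈Â) =
    c , c∈A , ⊆-trans e⊆w w⊆c

  #closed : ℕ
  #closed = length (filter Closed? (subsets a))

-- The Galois connection induced by a surjective morphism

module Induced {a b} {A : Code a} {B : Code b} (A? : Decidable (mem A)) (B? : Decidable (mem B))
               (B-neural : IsNeural B) {h : Subset a → Subset b}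
               (h-mor : IsMorphism A B h) (h-onto : SurjectiveOn A B h) where

  module A = Closure A?
  module B = Closure B?

  ĥ : Subset a → Subset b
  ĥ e = A.⋀ (e ⊆?_) h

  ǧ : Subset b → Subset a
  ǧ y = A.⋀ (λ c → y ⊆? h c) id

  ĥ-lb : ∀ {e c} → mem A c → e ⊆ c → ĥ e ⊆ h c
  ĥ-lb {e} = A.⋀-lb (e ⊆?_) h

  ĥ-glb : ∀ {e w} → (∀ c → mem A c → e ⊆ c → w ⊆ h c) → w ⊆ ĥ e
  ĥ-glb {e} = A.⋀-glb (e ⊆?_) h

  ǧ-lb : ∀ {y c} → mem A c → y ⊆ h c → ǧ y ⊆ c
  ǧ-lb {y} = A.⋀-lb (λ c → y ⊆? h c) id

  ǧ-glb : ∀ {y w} → (∀ c → mem A c → y ⊆ h c → w ⊆ c) → w ⊆ ǧ y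
  ǧ-glb {y} = A.⋀-glb (λ c → y ⊆? h c) id

  h-into : ∀ {c} → mem A c → mem B (h c)
  h-into = proj₁ h-mor _

  -- For σ ≠ ∅ the trunk Tk_B(σ) is proper because ⊥ ∈ B, so h-mor writes its preimage as
  -- Tk_A(τ); then τ ⊆ ǧ σ.
  ǧ-adjoint : Adjoint A B ǧ h
  ǧ-adjoint σ c σ-nonempty c∈A = mk⇔ (ǧ-lb c∈A) reflect
    where
    reflect : ǧ σ ⊆ c → σ ⊆ h c
    reflect ǧσ⊆c with σ ⊆? ⊥
    ... | yes σ⊆⊥ = ⊆-trans σ⊆⊥ ⊥⊆
    ... | no σ⊈⊥ with τ , _ , preimage ← proj₂ h-mor σ (σ-nonempty , λ all → σ⊈⊥ (all ⊥ B-neural))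
      = Equivalence.from (preimage c c∈A)
          (⊆-trans (ǧ-glb λ c′ c′∈A σ⊆hc′ → Equivalence.to (preimage c′ c′∈A) σ⊆hc′) ǧσ⊆c)

  h-mono : ∀ {c c′} → mem A c → mem A c′ → c ⊆ c′ → h c ⊆ h c′
  h-mono c∈A c′∈A c⊆c′ = Equivalence.from (ǧ-adjoint _ _ (_ , h-into c∈A , ⊆-refl) c′∈A)
                                            (⊆-trans (ǧ-lb c∈A ⊆-refl) c⊆c′)

  ĥ-codeword : ∀ {c} → mem A c → ĥ c ≡ h c
  ĥ-codeword c∈A = ⊆-antisym (ĥ-lb c∈A ⊆-refl) (ĥ-glb λ c′ c′∈A → h-mono c∈A c′∈A)

  ĥ-mono : ∀ {e e′} → e ⊆ e′ → ĥ e ⊆ ĥ e′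
  ĥ-mono e⊆e′ = ĥ-glb λ c c∈A e′⊆c → ĥ-lb c∈A (⊆-trans e⊆e′ e′⊆c)

  ǧ-mono : ∀ {y y′} → y ⊆ y′ → ǧ y ⊆ ǧ y′
  ǧ-mono y⊆y′ = ǧ-glb λ c c∈A y′⊆hc → ǧ-lb c∈A (⊆-trans y⊆y′ y′⊆hc)

  ĥ-cl : ∀ {e} → ĥ (A.cl e) ⊆ ĥ e
  ĥ-cl = ĥ-glb λ c c∈A e⊆c → ĥ-lb c∈A (A.cl-lb c∈A e⊆c)

  ĥ⊥ : ĥ ⊥ ≡ ⊥
  ĥ⊥ with c , c∈A , hc≡⊥ ← h-onto ⊥ B-neural = ⊆-antisym (subst (ĥ ⊥ ⊆_) hc≡⊥ (ĥ-lb c∈A ⊥⊆)) ⊥⊆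

  ĥ-nonempty : ∀ {e} → NonemptyTk A e → NonemptyTk B (ĥ e)
  ĥ-nonempty (c , c∈A , e⊆c) = h c , h-into c∈A , ĥ-lb c∈A e⊆c

  ǧ-nonempty : ∀ {y} → NonemptyTk B y → NonemptyTk A (ǧ y)
  ǧ-nonempty (d , d∈B , y⊆d) with c , c∈A , refl ← h-onto d d∈B = c , c∈A , ǧ-lb c∈A y⊆d

  ĥ-closed : ∀ {e} → NonemptyTk A e → B.Closed (ĥ e)
  ĥ-closed e-nonempty =
    ĥ-nonempty e-nonempty , ĥ-glb λ c c∈A e⊆c → B.cl-lb (h-into c∈A) (ĥ-lb c∈A e⊆c)

  ǧ-closed : ∀ {y} → NonemptyTk B y → A.Closed (ǧ y)
  ǧ-closed y-nonempty =
    ǧ-nonempty y-nonempty , ǧ-glb λ c c∈A y⊆hc → A.cl-lb c∈A (ǧ-lb c∈A y⊆hc)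

  galois : ∀ {y e} → NonemptyTk B y → A.Closed e → (ǧ y ⊆ e ⇔ y ⊆ ĥ e)
  galois {y} {e} y-nonempty (_ , cl-e⊆e) = mk⇔ to from
    where
    to : ǧ y ⊆ e → y ⊆ ĥ e
    to ǧy⊆e = ĥ-glb λ c c∈A e⊆c →
      Equivalence.from (ǧ-adjoint y c y-nonempty c∈A) (⊆-trans ǧy⊆e e⊆c)
    from : y ⊆ ĥ e → ǧ y ⊆ e
    from y⊆ĥe = ⊆-trans (A.cl-glb λ c c∈A e⊆c → ǧ-lb c∈A (⊆-trans y⊆ĥe (ĥ-lb c∈A e⊆c))) cl-e⊆e

  ĥǧ : ∀ {y} → B.Closed y → ĥ (ǧ y) ≡ y
  ĥǧ {y} y-closed@(y-nonempty , cl-y⊆y) = ⊆-antisym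
    (⊆-trans (B.cl-glb ĥǧy-below) cl-y⊆y)
    (Equivalence.to (galois y-nonempty (ǧ-closed y-nonempty)) ⊆-refl)
    where
    ĥǧy-below : ∀ d → mem B d → y ⊆ d → ĥ (ǧ y) ⊆ d
    ĥǧy-below d d∈B y⊆d with c , c∈A , refl ← h-onto d d∈B = ĥ-lb c∈A (ǧ-lb c∈A y⊆d)

  ǧĥ⊆ : ∀ {e} → A.Closed e → ǧ (ĥ e) ⊆ e
  ǧĥ⊆ e-closed = Equivalence.from (galois (ĥ-nonempty (proj₁ e-closed)) e-closed) ⊆-refl

  moved⇒⊈ : ∀ {e} → A.Closed e → ǧ (ĥ e) ≢ e → ¬ (e ⊆ ǧ (ĥ e))
  moved⇒⊈ e-closed e-moved e⊆ǧĥe = e-moved (⊆-antisym (ǧĥ⊆ e-closed) e⊆ǧĥe)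

  ĥ-∩ : ∀ {e e′} → A.Closed e → A.Closed e′ → ĥ (e ∩ e′) ≡ ĥ e ∩ ĥ e′
  ĥ-∩ {e} {e′} e-closed e′-closed = ⊆-antisym
    (∩-greatest (ĥ-mono (p∩q⊆p e e′)) (ĥ-mono (p∩q⊆q e e′)))
    (Equivalence.to (galois meet-nonempty (A.∩-closed e-closed e′-closed))
      (∩-greatest (Equivalence.from (galois meet-nonempty e-closed) (p∩q⊆p (ĥ e) (ĥ e′)))
                  (Equivalence.from (galois meet-nonempty e′-closed) (p∩q⊆q (ĥ e) (ĥ e′)))))
    where
    meet-nonempty : NonemptyTk B (ĥ e ∩ ĥ e′)
    meet-nonempty with d , d∈B , ĥe⊆d ← ĥ-nonempty (proj₁ e-closed) =
      d , d∈B , ⊆-trans (p∩q⊆p (ĥ e) (ĥ e′)) ĥe⊆d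

  ĥ-unique : ∀ {g e w} → Adjoint A B g h → A.Closed e → NonemptyTk B w →
             (∀ σ → NonemptyTk B σ → (σ ⊆ w ⇔ g σ ⊆ e)) → ĥ e ≡ w
  ĥ-unique {g} {e} {w} adj e-closed@(e-nonempty , cl-e⊆e) w-nonempty w-adj = ⊆-antisym
    (Equivalence.from (w-adj (ĥ e) (ĥ-nonempty e-nonempty))
      (⊆-trans (A.cl-glb λ c c∈A e⊆c →
                  Equivalence.to (adj (ĥ e) c (ĥ-nonempty e-nonempty) c∈A) (ĥ-lb c∈A e⊆c))
               cl-e⊆e))
    (ĥ-glb λ c c∈A e⊆c → Equivalence.from (adj w c w-nonempty c∈A)
      (⊆-trans (Equivalence.to (w-adj w w-nonempty) ⊆-refl) e⊆c))

  private
    closedA : List (Subset a)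
    closedA = filter A.Closed? (subsets a)

    closedB : List (Subset b)
    closedB = filter B.Closed? (subsets b)

    ∈-closedA : ∀ {e} → A.Closed e → e ∈ₗ closedA
    ∈-closedA = ∈-filter⁺ A.Closed? (∈-subsets _)

    closedB-closed : ∀ {y} → y ∈ₗ closedB → B.Closed y
    closedB-closed = proj₂ ∘ ∈-filter⁻ B.Closed? {xs = subsets b}

    ǧ[closedB]-unique : Unique (map ǧ closedB)
    ǧ[closedB]-unique =
      Unique.map⁻ (subst Unique (sym ĥǧ[closedB]) (Unique.filter⁺ B.Closed? (subsets-unique b)))
      where
      ĥǧ[closedB] : map ĥ (map ǧ closedB) ≡ closedB
      ĥǧ[closedB] = trans (sym (map-∘ closedB))
                          (map-id-local (All.map ĥǧ (all-filter B.Closed? (subsets b))))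

    ǧ[closedB]⊆closedA : map ǧ closedB ⊆ₗ closedA
    ǧ[closedB]⊆closedA e∈ with y , y∈ , refl ← ∈-map⁻ ǧ e∈ =
      ∈-closedA (ǧ-closed (proj₁ (closedB-closed y∈)))

  -- ǧ embeds B̂ into Â, and no moved e lies in its image.
  #closed≤ : B.#closed ≤ A.#closed
  #closed≤ = subst (_≤ A.#closed) (length-map ǧ closedB)
                   (Unique-⊆⇒length≤ _≟_ ǧ[closedB]-unique ǧ[closedB]⊆closedA)

  #closed< : ∀ {e} → A.Closed e → ǧ (ĥ e) ≢ e → B.#closed < A.#closed
  #closed< {e} e-closed e-moved = subst (_< A.#closed) (length-map ǧ closedB)
    (Unique-⊂⇒length< _≟_ ǧ[closedB]-unique ǧ[closedB]⊆closedA (∈-closedA e-closed) e∉ǧ[closedB])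
    where
    e∉ǧ[closedB] : e ∉ₗ map ǧ closedB
    e∉ǧ[closedB] e∈ with y , y∈ , refl ← ∈-map⁻ ǧ e∈ = e-moved (cong ǧ (ĥǧ (closedB-closed y∈)))

  fixed⇒≅ : (∀ e → A.Closed e → ǧ (ĥ e) ≡ e) → A ≅ B
  fixed⇒≅ fixed = inverse-adjoints⇒≅ (λ _ → h-into) ǧ-into ǧh hǧ ǧ-adjoint ĥ-adjoint
    where
    ǧh : ∀ c → mem A c → ǧ (h c) ≡ c
    ǧh c c∈A = trans (cong ǧ (sym (ĥ-codeword c∈A))) (fixed c (A.codeword-closed c∈A))

    ǧ-into : ∀ d → mem B d → mem A (ǧ d)
    ǧ-into d d∈B with c , c∈A , refl ← h-onto d d∈B = subst (mem A) (sym (ǧh c c∈A)) c∈A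

    hǧ : ∀ d → mem B d → h (ǧ d) ≡ d
    hǧ d d∈B = trans (sym (ĥ-codeword (ǧ-into d d∈B))) (ĥǧ (B.codeword-closed d∈B))

    ĥ-adjoint : Adjoint B A ĥ ǧ
    ĥ-adjoint σ d σ-nonempty d∈B = mk⇔ to from
      where
      to : σ ⊆ ǧ d → ĥ σ ⊆ d
      to σ⊆ǧd = subst (ĥ σ ⊆_) (hǧ d d∈B) (ĥ-lb (ǧ-into d d∈B) σ⊆ǧd)
      from : ĥ σ ⊆ d → σ ⊆ ǧ d
      from ĥσ⊆d = ⊆-trans A.⊆-cl (subst (_⊆ ǧ d) (fixed _ (A.cl-closed σ-nonempty))
                                               (ǧ-mono (⊆-trans ĥ-cl ĥσ⊆d)))

  some-moved : ¬ (A ≅ B) → ∃ λ x → A.Closed x × ǧ (ĥ x) ≢ x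
  some-moved A≇B with anySubset? (λ e → A.Closed? e ×-dec ¬? (ǧ (ĥ e) ≟ e))
  ... | yes moved = moved
  ... | no none   = ⊥-elim (A≇B (fixed⇒≅ λ e e-closed →
                      decidable-stable (ǧ (ĥ e) ≟ e) λ e-moved → none (e , e-closed , e-moved)))

  module Marking (x : Subset a) where

    mark : Subset a → Subset (suc b)
    mark e = does (x ⊆? e) ∷ ĥ e

    -- The x ∪ _ is what makes unmark a lower adjoint of mark (mark-adjoint).
    unmark : Subset (suc b) → Subset a
    unmark (inside  ∷ y) = x ∪ ǧ y
    unmark (outside ∷ y) = ǧ y

    mark-mono : ∀ {e e′} → e ⊆ e′ → mark e ⊆ mark e′
    mark-mono {e} {e′} e⊆e′ with x ⊆? e | x ⊆? e′
    ... | yes _   | yes _    = in⊆in (ĥ-mono e⊆e′)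
    ... | yes x⊆e | no x⊈e′ = ⊥-elim (x⊈e′ (⊆-trans x⊆e e⊆e′))
    ... | no _    | _        = out⊆ (ĥ-mono e⊆e′)

    mark-adjoint : ∀ {z c} → NonemptyTk B (tail z) → A.Closed c → (z ⊆ mark c ⇔ unmark z ⊆ c)
    mark-adjoint {outside ∷ s} s-nonempty c-closed =
      ⇔.trans (⇔.sym out⊆-⇔) (⇔.sym (galois s-nonempty c-closed))
    mark-adjoint {inside ∷ s} {c} s-nonempty c-closed =
      ⇔.trans (in⊆does-⇔ (x ⊆? c))
              (⇔.trans (⇔.refl ×-⇔ ⇔.sym (galois s-nonempty c-closed)) (⇔.sym ∪-⊆-⇔))

  module Splitting {x} (x-closed : A.Closed x) (x-moved : ǧ (ĥ x) ≢ x)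
                   (only-x-moves : ∀ e → A.Closed e → e ≢ x → ǧ (ĥ e) ≡ e) where

    open Marking x

    μ : Subset b
    μ = ĥ x

    I : Subset b → Set
    I y = ∃ λ e → A.Closed e × x ⊆ e × ĥ e ≡ y

    x∪ǧĥ : ∀ {e} → A.Closed e → x ⊆ e → x ∪ ǧ (ĥ e) ≡ e
    x∪ǧĥ {e} e-closed x⊆e with e ≟ x
    ... | yes refl = q⊆p⇒p∪q≡p (ǧĥ⊆ x-closed)
    ... | no e≢x   = trans (cong (x ∪_) (only-x-moves e e-closed e≢x)) (p⊆q⇒p∪q≡q x⊆e)

    unmark-mark : ∀ {e} → A.Closed e → unmark (mark e) ≡ e
    unmark-mark {e} e-closed with x ⊆? e
    ... | yes x⊆e = x∪ǧĥ e-closed x⊆e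
    ... | no x⊈e  = only-x-moves e e-closed λ { refl → x⊈e ⊆-refl }

    least : IsLeast I μ
    least = (x , x-closed , ⊆-refl , refl) , λ { _ (e , _ , x⊆e , refl) → ĥ-mono x⊆e }

    I-closed : ∀ {y} → I y → B.Closed y
    I-closed (e , e-closed , _ , refl) = ĥ-closed (proj₁ e-closed)

    ǧ-I : ∀ {y} → B.Closed y → x ⊆ ǧ y → I y
    ǧ-I y-closed x⊆ǧy = _ , ǧ-closed (proj₁ y-closed) , x⊆ǧy , ĥǧ y-closed

    I⇒x⊆ǧ : ∀ {y} → I y → y ≢ μ → x ⊆ ǧ y
    I⇒x⊆ǧ (e , e-closed , x⊆e , refl) ĥe≢μ =
      subst (x ⊆_) (sym (only-x-moves e e-closed λ { refl → ĥe≢μ refl })) x⊆e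

    isolated : Isolated (completion B) I
    isolated = (λ _ Iy → B.closed⇒completion (I-closed Iy)) , (μ , proj₁ least) , I-∩ , isolation
      where
      I-∩ : ∀ y y′ → I y → I y′ → I (y ∩ y′)
      I-∩ _ _ (e , e-closed , x⊆e , refl) (e′ , e′-closed , x⊆e′ , refl) =
        e ∩ e′ , A.∩-closed e-closed e′-closed , ∩-greatest x⊆e x⊆e′ , ĥ-∩ e-closed e′-closed

      isolation : ∀ μ′ → IsLeast I μ′ →
                  ¬ (∃₂ λ σ τ → mem (completion B) σ × ¬ I σ × I τ × τ ≢ μ′ × τ ⊆ σ)
      isolation μ′ (Iμ′ , μ′-least) (σ , τ , σ∈B̂ , ¬Iσ , Iτ , τ≢μ′ , τ⊆σ) =
        ¬Iσ (ǧ-I (B.completion⇒closed σ∈B̂) (⊆-trans (I⇒x⊆ǧ Iτ τ≢μ) (ǧ-mono τ⊆σ)))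
        where
        τ≢μ : τ ≢ μ
        τ≢μ = subst (τ ≢_) (⊆-antisym (μ′-least μ (proj₁ least)) (proj₂ least μ′ Iμ′)) τ≢μ′

    S : Code (suc b)
    S = split (completion B) I μ

    tail-closed : ∀ z → mem S z → B.Closed (tail z)
    tail-closed (inside  ∷ _) Iy                  = I-closed Iy
    tail-closed (outside ∷ _) (inj₁ refl)         = ĥ-closed (proj₁ x-closed)
    tail-closed (outside ∷ _) (inj₂ (y∈B̂ , _))   = B.completion⇒closed y∈B̂

    mark-into : ∀ e → mem (completion A) e → mem S (mark e)
    mark-into e e∈Â with e-closed ← A.completion⇒closed e∈Â | x ⊆? e
    ... | yes x⊆e = e , e-closed , x⊆e , refl
    ... | no x⊈e with ĥ e ≟ μ
    ...   | yes ĥe≡μ = inj₁ ĥe≡μ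
    ...   | no ĥe≢μ  = inj₂ (B.closed⇒completion (ĥ-closed (proj₁ e-closed)) , ¬Iĥe)
      where
      ¬Iĥe : ¬ I (ĥ e)
      ¬Iĥe Iĥe = x⊈e (subst (x ⊆_) (only-x-moves e e-closed λ { refl → x⊈e ⊆-refl })
                                   (I⇒x⊆ǧ Iĥe ĥe≢μ))

    unmark-closed : ∀ z → mem S z → A.Closed (unmark z)
    unmark-closed (inside  ∷ _) (e , e-closed , x⊆e , refl) =
      subst A.Closed (sym (x∪ǧĥ e-closed x⊆e)) e-closed
    unmark-closed (outside ∷ y) z∈S = ǧ-closed (proj₁ (tail-closed (outside ∷ y) z∈S))

    mark-unmark : ∀ z → mem S z → mark (unmark z) ≡ z
    mark-unmark (inside ∷ _) (e , e-closed , x⊆e , refl) =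
      trans (cong mark (x∪ǧĥ e-closed x⊆e)) (cong (_∷ ĥ e) (dec-true (x ⊆? e) x⊆e))
    mark-unmark (outside ∷ y) z∈S =
      cong₂ _∷_ (dec-false (x ⊆? ǧ y) (x⊈ǧy z∈S)) (ĥǧ (tail-closed (outside ∷ y) z∈S))
      where
      x⊈ǧy : mem S (outside ∷ y) → ¬ (x ⊆ ǧ y)
      x⊈ǧy (inj₁ refl)         = moved⇒⊈ x-closed x-moved
      x⊈ǧy (inj₂ (y∈B̂ , ¬Iy)) = ¬Iy ∘ ǧ-I (B.completion⇒closed y∈B̂)

    nonempty-tail : ∀ {z} → NonemptyTk S z → NonemptyTk B (tail z)
    nonempty-tail (w , w∈S , z⊆w) with d , d∈B , tail-w⊆d ← proj₁ (tail-closed w w∈S) =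
      d , d∈B , ⊆-trans (tail-mono z⊆w) tail-w⊆d

    mark-adjoint-S : Adjoint (completion A) S unmark mark
    mark-adjoint-S z c z-nonempty c∈Â =
      mark-adjoint (nonempty-tail z-nonempty) (A.completion⇒closed c∈Â)

    unmark-adjoint : Adjoint S (completion A) (mark ∘ A.cl) unmark
    unmark-adjoint σ z σ-nonempty z∈S = begin
      σ ⊆ unmark z                       ∼⟨ mk⇔ (A.closed-lub unmark-z-closed) (⊆-trans A.⊆-cl) ⟩
      A.cl σ ⊆ unmark z                  ≡⟨ cong (_⊆ unmark z) (sym (unmark-mark cl-σ-closed)) ⟩
      unmark (mark (A.cl σ)) ⊆ unmark z  ∼⟨ ⇔.sym (mark-adjoint cl-σ-nonempty unmark-z-closed) ⟩
      mark (A.cl σ) ⊆ mark (unmark z)    ≡⟨ cong (mark (A.cl σ) ⊆_) (mark-unmark z z∈S) ⟩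
      mark (A.cl σ) ⊆ z                  ∎
      where
      open Related.EquationalReasoning
      unmark-z-closed : A.Closed (unmark z)
      unmark-z-closed = unmark-closed z z∈S
      cl-σ-closed : A.Closed (A.cl σ)
      cl-σ-closed = A.cl-closed (A.completion-nonempty σ-nonempty)
      cl-σ-nonempty : NonemptyTk B (ĥ (A.cl σ))
      cl-σ-nonempty = ĥ-nonempty (proj₁ cl-σ-closed)

    completion≅split : completion A ≅ S
    completion≅split = inverse-adjoints⇒≅
      mark-into (λ z z∈S → A.closed⇒completion (unmark-closed z z∈S))
      (λ e e∈Â → unmark-mark (A.completion⇒closed e∈Â)) mark-unmark
      mark-adjoint-S unmark-adjoint

module _ {a b} {A : Code a} {B : Code b} (A? : Decidable (mem A)) (B? : Decidable (mem B))
         (A-neural : IsNeural A) (B-neural : IsNeural B) {h : Subset a → Subset b}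
         (h-mor : IsMorphism A B h) (h-onto : SurjectiveOn A B h) where

  open Induced A? B? B-neural h-mor h-onto

  collapse⇒≇ : ∀ {e₁ e₂} → A.Closed e₁ → A.Closed e₂ → e₁ ≢ e₂ → ĥ e₁ ≡ ĥ e₂ → ¬ (A ≅ B)
  collapse⇒≇ {e₁} {e₂} e₁-closed e₂-closed e₁≢e₂ ĥe₁≡ĥe₂ A≅B
    with ψ , ψ-mor , ψ-onto ← ≅⇒≤C A≅B =
    <⇒≱ B<A (Induced.#closed≤ B? A? A-neural ψ-mor ψ-onto)
    where
    B<A : B.#closed < A.#closed
    B<A with ǧ (ĥ e₁) ≟ e₁
    ... | no e₁-moved = #closed< e₁-closed e₁-moved
    ... | yes e₁-fixed = #closed< e₂-closed λ e₂-fixed →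
      e₁≢e₂ (trans (sym e₁-fixed) (trans (cong ǧ ĥe₁≡ĥe₂) e₂-fixed))

-- Codes strictly between D and C

module Covering {a b} {A : Code a} {B : Code b} (A? : Decidable (mem A)) (B? : Decidable (mem B))
                (A-neural : IsNeural A) (B-neural : IsNeural B) {h : Subset a → Subset b}
                (h-mor : IsMorphism A B h) (h-onto : SurjectiveOn A B h) where

  open Induced A? B? B-neural h-mor h-onto

  module Intermediate {x y} (x-closed : A.Closed x) (y-closed : A.Closed y)
           (x-moved : ǧ (ĥ x) ≢ x) (y-moved : ǧ (ĥ y) ≢ y) (x⊈y : ¬ (x ⊆ y)) where

    open Marking x

    E : Code (suc b)
    E = record { mem = λ z → ∃ λ c → mem A c × mark c ≡ z }

    E? : Decidable (mem E)
    E? z = anySubset? λ c → A? c ×-dec (mark c ≟ z)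

    E-neural : IsNeural E
    E-neural = ⊥ , A-neural , cong₂ _∷_ (dec-false (x ⊆? ⊥) x⊈⊥) ĥ⊥
      where
      x⊈⊥ : ¬ (x ⊆ ⊥)
      x⊈⊥ x⊆⊥ = moved⇒⊈ x-closed x-moved (⊆-trans x⊆⊥ ⊥⊆)

    mark-onto : SurjectiveOn A E mark
    mark-onto _ z∈E = z∈E

    nonempty-tail : ∀ {z} → NonemptyTk E z → NonemptyTk B (tail z)
    nonempty-tail (_ , (c , c∈A , refl) , z⊆markc) =
      h c , h-into c∈A , ⊆-trans (tail-mono z⊆markc) (ĥ-lb c∈A ⊆-refl)

    mark-adjoint-E : Adjoint A E unmark mark
    mark-adjoint-E z c z-nonempty c∈A =
      mark-adjoint (nonempty-tail z-nonempty) (A.codeword-closed c∈A)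

    mark-mor : IsMorphism A E mark
    mark-mor = adjoint⇒IsMorphism (λ c c∈A → c , c∈A , refl) mark-onto mark-adjoint-E

    tail-into : ∀ z → mem E z → mem B (tail z)
    tail-into _ (c , c∈A , refl) = subst (mem B) (sym (ĥ-codeword c∈A)) (h-into c∈A)

    tail-onto : SurjectiveOn E B tail
    tail-onto d d∈B with c , c∈A , refl ← h-onto d d∈B = mark c , (c , c∈A , refl) , ĥ-codeword c∈A

    tail-adjoint : Adjoint E B (outside ∷_) tail
    tail-adjoint σ z _ _ = ⊆-tail-⇔ z

    tail-mor : IsMorphism E B tail
    tail-mor = adjoint⇒IsMorphism tail-into tail-onto tail-adjoint

    module Mark = Induced A? E? E-neural mark-mor mark-onto
    module Tail = Induced E? B? B-neural tail-mor tail-onto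

    ĥ-mark : ∀ {e} → A.Closed e → Mark.ĥ e ≡ mark e
    ĥ-mark e-closed@((c , c∈A , e⊆c) , _) = Mark.ĥ-unique mark-adjoint-E e-closed
      (mark c , (c , c∈A , refl) , mark-mono e⊆c)
      (λ σ σ-nonempty → mark-adjoint (nonempty-tail σ-nonempty) e-closed)

    mark-closed : ∀ {e} → A.Closed e → Mark.B.Closed (mark e)
    mark-closed e-closed = subst Mark.B.Closed (ĥ-mark e-closed) (Mark.ĥ-closed (proj₁ e-closed))

    ĥ-tail : ∀ {w} → Mark.B.Closed w → Tail.ĥ w ≡ tail w
    ĥ-tail {w} w-closed@((z , z∈E , w⊆z) , _) = Tail.ĥ-unique tail-adjoint w-closed
      (tail z , tail-into z z∈E , tail-mono w⊆z) (λ σ _ → ⊆-tail-⇔ w)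

    ǧĥ-closed : ∀ {e} → A.Closed e → A.Closed (ǧ (ĥ e))
    ǧĥ-closed e-closed = ǧ-closed (ĥ-nonempty (proj₁ e-closed))

    ĥǧĥ : ∀ {e} → A.Closed e → ĥ (ǧ (ĥ e)) ≡ ĥ e
    ĥǧĥ e-closed = ĥǧ (ĥ-closed (proj₁ e-closed))

    A≇E : ¬ (A ≅ E)
    A≇E = collapse⇒≇ A? E? A-neural E-neural mark-mor mark-onto
      y-closed (ǧĥ-closed y-closed) (≢-sym y-moved)
      (begin
        Mark.ĥ y                    ≡⟨ ĥ-mark y-closed ⟩
        mark y                      ≡⟨ cong (_∷ ĥ y) (dec-false (x ⊆? y) x⊈y) ⟩
        outside ∷ ĥ y               ≡⟨ cong₂ _∷_ (dec-false (x ⊆? ǧ (ĥ y)) x⊈ǧĥy) (ĥǧĥ y-closed) ⟨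
        mark (ǧ (ĥ y))              ≡⟨ ĥ-mark (ǧĥ-closed y-closed) ⟨
        Mark.ĥ (ǧ (ĥ y))            ∎)
      where
      open ≡-Reasoning
      x⊈ǧĥy : ¬ (x ⊆ ǧ (ĥ y))
      x⊈ǧĥy x⊆ǧĥy = x⊈y (⊆-trans x⊆ǧĥy (ǧĥ⊆ y-closed))

    E≇B : ¬ (E ≅ B)
    E≇B = collapse⇒≇ E? B? E-neural B-neural tail-mor tail-onto
      (mark-closed x-closed) (mark-closed (ǧĥ-closed x-closed)) heads-differ
      (begin
        Tail.ĥ (mark x)             ≡⟨ ĥ-tail (mark-closed x-closed) ⟩
        ĥ x                         ≡⟨ ĥǧĥ x-closed ⟨
        ĥ (ǧ (ĥ x))                 ≡⟨ ĥ-tail (mark-closed (ǧĥ-closed x-closed)) ⟨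
        Tail.ĥ (mark (ǧ (ĥ x)))     ∎)
      where
      open ≡-Reasoning
      heads-differ : mark x ≢ mark (ǧ (ĥ x))
      heads-differ eq with x ⊆? x | x ⊆? ǧ (ĥ x)
      ... | no x⊈x | _        = x⊈x ⊆-refl
      ... | yes _  | yes x⊆ǧĥx = moved⇒⊈ x-closed x-moved x⊆ǧĥx
      heads-differ () | yes _ | no _

    between : Σ ℕ λ k → Σ (Code k) λ E → IsNeural E × B <C E × E <C A
    between = suc b , E , E-neural ,
              ((tail , tail-mor , tail-onto) , E≇B) , ((mark , mark-mor , mark-onto) , A≇E)

  only-one-moved : ¬ (Σ ℕ λ k → Σ (Code k) λ E → IsNeural E × B <C E × E <C A) →
                   ∀ {x} → A.Closed x → ǧ (ĥ x) ≢ x → ∀ e → A.Closed e → e ≢ x → ǧ (ĥ e) ≡ e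
  only-one-moved nothing-between {x} x-closed x-moved e e-closed e≢x with ǧ (ĥ e) ≟ e | x ⊆? e
  ... | yes e-fixed | _       = e-fixed
  ... | no e-moved  | yes x⊆e = ⊥-elim (nothing-between
        (Intermediate.between e-closed x-closed e-moved x-moved λ e⊆x → e≢x (⊆-antisym e⊆x x⊆e)))
  ... | no e-moved  | no x⊈e  = ⊥-elim (nothing-between
        (Intermediate.between x-closed e-closed x-moved e-moved x⊈e))

theorem15 : ∀ {n m} (C : Code n) (D : Code m) →
    IsNeural C → IsNeural D →
    (∀ c → Dec (mem C c)) → (∀ d → Dec (mem D d)) →
    Covers C D →
    Σ (Subset m → Set) λ I → Σ (Subset m) λ μ →
      Isolated (completion D) I × IsLeast I μ ×
      (completion C ≅ split (completion D) I μ)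
theorem15 C D C-neural D-neural C? D? (((f , f-mor , f-onto) , C≇D) , nothing-between)
  with x , x-closed , x-moved ← Induced.some-moved C? D? D-neural f-mor f-onto C≇D
  = I , μ , isolated , least , completion≅split
  where
  open Induced.Splitting C? D? D-neural f-mor f-onto x-closed x-moved
    (Covering.only-one-moved C? D? C-neural D-neural f-mor f-onto nothing-between x-closed x-moved)
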